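{- Let $L$ be a fixed triangulation of the once-punctured torus, $t\mapsto L_t=(\ell_{1;t},\ell_{2;t},\ell_{3;t})$ the cluster pattern with initial triangulation $L$, $t\in\mathbb{T}_3$, and $\{i,j,k\}=\{1,2,3\}$. Assume $\mathrm{grad}_L(\ell_{i;t})<\mathrm{grad}_L(\ell_{j;t})<\mathrm{grad}_L(\ell_{k;t})$. (1) If $L_{t'}=(\dots)$ is obtained from $L_t$ by the flip in direction $j$, replacing $\ell_{j;t}$ by $\ell_{j;t'}$, then $\mathrm{grad}_L(\ell_{j;t'})<\mathrm{grad}_L(\ell_{i;t})<\mathrm{grad}_L(\ell_{k;t})$ or $\mathrm{grad}_L(\ell_{i;t})<\mathrm{grad}_L(\ell_{k;t})<\mathrm{grad}_L(\ell_{j;t'})$. (2) If $L_{t''}$ is obtained from $L_t$ by the flip in direction $i$, replacing $\ell_{i;t}$ by $\ell_{i;t''}$, then $\mathrm{grad}_L(\ell_{j;t})<\mathrm{grad}_L(\ell_{i;t''})<\mathrm{grad}_L(\ell_{k;t})$. (3) If $L_{t'''}$ is obtained from $L_t$ by the flip in direction $k$, replacing $\ell_{k;t}$ by $\ell_{k;t'''}$, then $\mathrm{grad}_L(\ell_{i;t})<\mathrm{grad}_L(\ell_{k;t'''})<\mathrm{grad}_L(\ell_{j;t})$.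
   Context: $S$ is a torus with one puncture $p$; an arc is an isotopy class of a non-contractible simple curve from $p$ to $p$ with interior in $S\setminus\{p\}$; a triangulation is an ordered triple $(m_1,m_2,m_3)$ of distinct arcs with pairwise disjoint interiors; the flip $\varphi_k$ replaces the $k$-th arc by the unique other arc giving a triangulation. $\mathbb{T}_3$ is the 3-regular tree with edges labeled $1,2,3$ distinctly at each vertex; the cluster pattern assigns $L$ to a fixed root $t_0$ and $L_{t'}=\varphi_k(L_t)$ whenever $t,t'$ are joined by an edge labeled $k$. Fix $L=(\ell_1,\ell_2,\ell_3)$ and identify the universal cover of the torus with $\mathbb{R}^2$ so that the preimage of $p$ is $\mathbb{Z}^2$ and the lifts of $\ell_1,\ell_2,\ell_3$ are straight lattice segments of slopes $0,\infty,-1$. Every arc lifts to straight segments from $P$ to $P+(x,y)$ with $\gcd(x,y)=1$; its gradient is $\mathrm{grad}_L(\ell)=y/x\in\mathbb{Q}\cup\{\infty\}$, with $\infty$ regarded as larger than every rational number. -}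

module Defs where

open import Data.Nat as ℕ using (ℕ; zero; suc)
open import Data.Nat.GCD using (gcd)
open import Data.Integer as ℤ using (ℤ; +_; ∣_∣)
open import Data.Rational as ℚ using (ℚ)
import Data.Fin as Fin
open Fin using (Fin)
open import Data.Product using (_×_)
open import Data.Unit using (⊤)
open import Data.Empty using (⊥)
open import Relation.Nullary using (¬_)
open import Relation.Binary.PropositionalEquality using (_≡_; _≢_; refl)

-- Arcs of the once-punctured torus, via their straight lifts in the
-- universal cover R^2 (puncture lifts = Z^2), coordinates chosen so that
-- the initial triangulation L = (ℓ₁,ℓ₂,ℓ₃) lifts to slopes 0, ∞, -1.
-- An arc is determined by its primitive direction vector (x,y), up to
-- sign; we take the normal form  x > 0,  or  x = 0 and y = 1.

Normal : ℕ → ℤ → Set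
Normal zero    y = y ≡ + 1
Normal (suc _) _ = ⊤

record Arc : Set where
  constructor arc
  field
    x      : ℕ
    y      : ℤ
    prim   : gcd ∣ y ∣ x ≡ 1
    normal : Normal x y
open Arc public

-- equality of arcs (same isotopy class = same normalised direction)
_≈ₐ_ : Arc → Arc → Set
a ≈ₐ b = (x a ≡ x b) × (y a ≡ y b)

ℓ₁ ℓ₂ ℓ₃ : Arc
ℓ₁ = arc 1 (+ 0) refl _
ℓ₂ = arc 0 (+ 1) refl refl
ℓ₃ = arc 1 (ℤ.- + 1) refl _

data Grad : Set where
  fin : ℚ → Grad
  ∞   : Grad

data _<ᵍ_ : Grad → Grad → Set where
  fin<fin : ∀ {p q} → p ℚ.< q → fin p <ᵍ fin q
  fin<∞   : ∀ {p} → fin p <ᵍ ∞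

grad : Arc → Grad
grad (arc zero    _ _ _) = ∞
grad (arc (suc n) y _ _) = fin (y ℚ./ suc n)

-- Disjointness of interiors: two distinct straight arcs on the torus
-- have disjoint interiors iff their direction vectors span Z^2,
-- i.e. |det| = 1.

det : Arc → Arc → ℤ
det a b = (+ x a) ℤ.* y b ℤ.- y a ℤ.* (+ x b)

Compatible : Arc → Arc → Set
Compatible a b = ∣ det a b ∣ ≡ 1

Triple : Set
Triple = Fin 3 → Arc

IsTriangulation : Triple → Set
IsTriangulation T =
  ∀ (m n : Fin 3) → m ≢ n → ¬ (T m ≈ₐ T n) × Compatible (T m) (T n)

-- T' = φ_k(T): T' is a triangulation agreeing with T off k, with a
-- different k-th arc (such T' exists and is unique).
IsFlip : Fin 3 → Triple → Triple → Set
IsFlip k T T' =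
  IsTriangulation T' × (∀ m → m ≢ k → T' m ≈ₐ T m) × ¬ (T' k ≈ₐ T k)

L : Triple
L Fin.zero = ℓ₁
L (Fin.suc Fin.zero) = ℓ₂
L (Fin.suc (Fin.suc Fin.zero)) = ℓ₃

-- Triangulations of the form L_t, t ∈ 𝕋₃, of the cluster pattern with
-- root L: obtained from L by a finite sequence of flips (a path in 𝕋₃).
data IsClusterTriangulation : Triple → Set where
  root : IsClusterTriangulation L
  step : ∀ {T T'} (k : Fin 3) → IsClusterTriangulation T → IsFlip k T T' →
         IsClusterTriangulation T'

{-# OPTIONS --safe #-}
module Submission where

open import Defs
open import Data.Fin using (Fin; zero; suc)
open import Data.Product using (_×_; _,_; proj₂)
open import Data.Sum using (_⊎_; inj₁; inj₂)
import Data.Sum as Sum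
open import Relation.Binary.PropositionalEquality
  using (_≡_; _≢_; refl; sym; trans; cong; cong₂; subst; subst₂; ≢-sym; module ≡-Reasoning)
open import Relation.Nullary using (¬_)
open import Data.Empty using (⊥; ⊥-elim)
open import Data.Nat using (zero; suc; z≤n; s≤s)
open import Data.Integer
  using (ℤ; +_; -[1+_]; ∣_∣; _*_; _+_; _-_; -_; 0ℤ; 1ℤ; -1ℤ; _<_; +<+)
import Data.Integer.Properties as ℤ
open import Data.Integer.Tactic.RingSolver using (solve-∀)
import Data.Rational as ℚ
import Data.Rational.Properties as ℚ
import Data.Rational.Unnormalised as ℚᵘ
import Data.Rational.Unnormalised.Properties as ℚᵘ

-- Identify an arc with its normalised direction vector in ℤ².  Compatibility
-- is det = ±1 and the sign of det a b is the gradient order, so when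
-- grad a < grad b < grad c in a triangulation all three determinants are 1.
-- By Cramer's rule an arc e compatible with both vectors of a basis (u, w),
-- det u w = 1, is det(e,w)·u + det(u,e)·w with coefficients ±1, and (-1,-1)
-- would put e below u and above w.  So e is u + w (gradient between u and w),
-- u - w (below u) or w - u (above w).  Since b = a + c, after each flip every
-- candidate other than the claimed ones is the replaced arc or its negative,
-- and a normalised arc is never the negative of another.

ℤ² : Set
ℤ² = ℤ × ℤ

0ᵥ : ℤ²
0ᵥ = 0ℤ , 0ℤ

infixl 6 _+ᵥ_
infixr 7 _•_

_+ᵥ_ : ℤ² → ℤ² → ℤ²
(x₁ , y₁) +ᵥ (x₂ , y₂) = x₁ + x₂ , y₁ + y₂

_•_ : ℤ → ℤ² → ℤ²
s • (x₁ , y₁) = s * x₁ , s * y₁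

detᵥ : ℤ² → ℤ² → ℤ
detᵥ (x₁ , y₁) (x₂ , y₂) = x₁ * y₂ - y₁ * x₂

•-identityˡ : ∀ v → 1ℤ • v ≡ v
•-identityˡ (x₁ , y₁) = cong₂ _,_ (ℤ.*-identityˡ x₁) (ℤ.*-identityˡ y₁)

cramer : ∀ u v w → detᵥ u w • v ≡ detᵥ v w • u +ᵥ detᵥ u v • w
cramer (x₁ , y₁) (x₂ , y₂) (x₃ , y₃) =
  cong₂ _,_ (first x₁ y₁ x₂ y₂ x₃ y₃) (second x₁ y₁ x₂ y₂ x₃ y₃)
  where
  first : ∀ x₁ y₁ x₂ y₂ x₃ y₃ →
    (x₁ * y₃ - y₁ * x₃) * x₂ ≡ (x₂ * y₃ - y₂ * x₃) * x₁ + (x₁ * y₂ - y₁ * x₂) * x₃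
  first = solve-∀
  second : ∀ x₁ y₁ x₂ y₂ x₃ y₃ →
    (x₁ * y₃ - y₁ * x₃) * y₂ ≡ (x₂ * y₃ - y₂ * x₃) * y₁ + (x₁ * y₂ - y₁ * x₂) * y₃
  second = solve-∀

neg-combination-cancel : ∀ s t u w → ((- s) • u +ᵥ (- t) • w) +ᵥ (s • u +ᵥ t • w) ≡ 0ᵥ
neg-combination-cancel s t (x₁ , y₁) (x₂ , y₂) = cong₂ _,_ (cancel s t x₁ x₂) (cancel s t y₁ y₂)
  where
  cancel : ∀ s t p q → ((- s) * p + (- t) * q) + (s * p + t * q) ≡ 0ℤ
  cancel = solve-∀

∣i∣≡1⇒i≡±1 : ∀ {i} → ∣ i ∣ ≡ 1 → i ≡ 1ℤ ⊎ i ≡ -1ℤ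
∣i∣≡1⇒i≡±1 {+ 1} _ = inj₁ refl
∣i∣≡1⇒i≡±1 { -[1+ 0 ]} _ = inj₂ refl
∣i∣≡1⇒i≡±1 {+ 0} ()
∣i∣≡1⇒i≡±1 {+ suc (suc _)} ()
∣i∣≡1⇒i≡±1 { -[1+ suc _ ]} ()

0<j-i⇒i<j : ∀ {i j} → 0ℤ < j - i → i < j
0<j-i⇒i<j {i} {j} 0<j-i = subst₂ _<_ (ℤ.+-identityˡ i) (cancel i j) (ℤ.+-monoˡ-< i 0<j-i)
  where
  cancel : ∀ i j → (j - i) + i ≡ j
  cancel = solve-∀

-- y ℚ./ suc n unfolds to fromℚᵘ (mkℚᵘ y n).
cross-<⇒/< : ∀ y₁ n₁ y₂ n₂ → y₁ * + suc n₂ < y₂ * + suc n₁ → y₁ ℚ./ suc n₁ ℚ.< y₂ ℚ./ suc n₂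
cross-<⇒/< y₁ n₁ y₂ n₂ cross = ℚ.toℚᵘ-cancel-<
  (ℚᵘ.<-respˡ-≃ (ℚᵘ.≃-sym (ℚ.toℚᵘ-fromℚᵘ (ℚᵘ.mkℚᵘ y₁ n₁)))
    (ℚᵘ.<-respʳ-≃ (ℚᵘ.≃-sym (ℚ.toℚᵘ-fromℚᵘ (ℚᵘ.mkℚᵘ y₂ n₂))) (ℚᵘ.*<* cross)))

vec : Arc → ℤ²
vec a = + x a , y a

vec-injective : ∀ {a b} → vec a ≡ vec b → a ≈ₐ b
vec-injective refl = refl , refl

-- Normalised directions lie in the half-plane x > 0 or x = 0 < y, closed under +.
vec-sum≢0 : ∀ a b → vec a +ᵥ vec b ≢ 0ᵥ
vec-sum≢0 (arc (suc _) _ _ _) _ ()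
vec-sum≢0 (arc zero _ _ _) (arc (suc _) _ _ _) ()
vec-sum≢0 (arc zero _ _ refl) (arc zero _ _ refl) ()

det-antisym : ∀ a b → det a b ≡ - det b a
det-antisym a b = antisym (+ x a) (y a) (+ x b) (y b)
  where
  antisym : ∀ p q r s → p * s - q * r ≡ - (r * q - s * p)
  antisym = solve-∀

compatible-cong : ∀ {a a' b b'} → a ≈ₐ a' → b ≈ₐ b' → Compatible a b → Compatible a' b'
compatible-cong (refl , refl) (refl , refl) compatible = compatible

<ᵍ-trans : ∀ {g h k} → g <ᵍ h → h <ᵍ k → g <ᵍ k
<ᵍ-trans (fin<fin p<q) (fin<fin q<r) = fin<fin (ℚ.<-trans p<q q<r)
<ᵍ-trans (fin<fin _) fin<∞ = fin<∞

<ᵍ-asym : ∀ {g h} → g <ᵍ h → h <ᵍ g → ⊥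
<ᵍ-asym (fin<fin p<q) (fin<fin q<p) = ℚ.<-asym p<q q<p

det>0⇒<ᵍ : ∀ a b → 0ℤ < det a b → grad a <ᵍ grad b
det>0⇒<ᵍ (arc zero _ _ refl) (arc zero _ _ refl) (+<+ ())
det>0⇒<ᵍ (arc zero _ _ refl) (arc (suc _) _ _ _) ()
det>0⇒<ᵍ (arc (suc _) _ _ _) (arc zero _ _ _) _ = fin<∞
det>0⇒<ᵍ (arc (suc n) y₁ _ _) (arc (suc m) y₂ _ _) 0<det =
  fin<fin (cross-<⇒/< y₁ n y₂ m (0<j-i⇒i<j 0<cross))
  where
  0<cross : 0ℤ < y₂ * + suc n - y₁ * + suc m
  0<cross = subst (λ z → 0ℤ < z - y₁ * + suc m) (ℤ.*-comm (+ suc n) y₂) 0<det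

det≡1⇒<ᵍ : ∀ a b → det a b ≡ 1ℤ → grad a <ᵍ grad b
det≡1⇒<ᵍ a b det≡1 = det>0⇒<ᵍ a b (subst (0ℤ <_) (sym det≡1) (+<+ (s≤s z≤n)))

det≡-1⇒>ᵍ : ∀ a b → det a b ≡ -1ℤ → grad b <ᵍ grad a
det≡-1⇒>ᵍ a b det≡-1 = det≡1⇒<ᵍ b a (trans (det-antisym b a) (cong -_ det≡-1))

compatible⇒det≡1 : ∀ a b → Compatible a b → grad a <ᵍ grad b → det a b ≡ 1ℤ
compatible⇒det≡1 a b compatible a<b with ∣i∣≡1⇒i≡±1 compatible
... | inj₁ det≡1 = det≡1
... | inj₂ det≡-1 = ⊥-elim (<ᵍ-asym a<b (det≡-1⇒>ᵍ a b det≡-1))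

data Position (u w e : Arc) : Set where
  below  : det u e ≡ -1ℤ → det e w ≡ 1ℤ  → Position u w e
  inside : det u e ≡ 1ℤ  → det e w ≡ 1ℤ  → Position u w e
  above  : det u e ≡ 1ℤ  → det e w ≡ -1ℤ → Position u w e

module _ (u w : Arc) (uw : det u w ≡ 1ℤ) where

  open ≡-Reasoning

  combination : ℤ → ℤ → ℤ²
  combination s t = s • vec u +ᵥ t • vec w

  coordinates : ∀ v → vec v ≡ combination (det v w) (det u v)
  coordinates v = begin
    vec v                      ≡⟨ sym (•-identityˡ (vec v)) ⟩
    1ℤ • vec v                 ≡⟨ cong (_• vec v) (sym uw) ⟩
    det u w • vec v            ≡⟨ cramer (vec u) (vec v) (vec w) ⟩
    combination (det v w) (det u v)  ∎

  same-coordinates⇒≈ₐ : ∀ e v → det u e ≡ det u v → det e w ≡ det v w → e ≈ₐ v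
  same-coordinates⇒≈ₐ e v ue≡uv ew≡vw = vec-injective {e} {v} (begin
    vec e                            ≡⟨ coordinates e ⟩
    combination (det e w) (det u e)  ≡⟨ cong₂ combination ew≡vw ue≡uv ⟩
    combination (det v w) (det u v)  ≡⟨ coordinates v ⟨
    vec v                            ∎)

  opposite-coordinates⇒⊥ : ∀ e v → det u e ≡ - det u v → det e w ≡ - det v w → ⊥
  opposite-coordinates⇒⊥ e v ue≡-uv ew≡-vw = vec-sum≢0 e v (begin
    vec e +ᵥ vec v
      ≡⟨ cong₂ _+ᵥ_ (coordinates e) (coordinates v) ⟩
    combination (det e w) (det u e) +ᵥ combination (det v w) (det u v)
      ≡⟨ cong₂ (λ s t → combination s t +ᵥ combination (det v w) (det u v)) ew≡-vw ue≡-uv ⟩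
    combination (- det v w) (- det u v) +ᵥ combination (det v w) (det u v)
      ≡⟨ neg-combination-cancel (det v w) (det u v) (vec u) (vec w) ⟩
    0ᵥ  ∎)

  position : ∀ e → Compatible u e → Compatible e w → Position u w e
  position e ue ew with ∣i∣≡1⇒i≡±1 ue | ∣i∣≡1⇒i≡±1 ew
  ... | inj₁ ue≡1  | inj₁ ew≡1  = inside ue≡1 ew≡1
  ... | inj₂ ue≡-1 | inj₁ ew≡1  = below ue≡-1 ew≡1
  ... | inj₁ ue≡1  | inj₂ ew≡-1 = above ue≡1 ew≡-1
  ... | inj₂ ue≡-1 | inj₂ ew≡-1 =
    ⊥-elim (<ᵍ-asym (det≡1⇒<ᵍ u w uw) (<ᵍ-trans (det≡-1⇒>ᵍ e w ew≡-1) (det≡-1⇒>ᵍ u e ue≡-1)))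

L-isTriangulation : IsTriangulation L
L-isTriangulation zero             zero             0≢0 = ⊥-elim (0≢0 refl)
L-isTriangulation zero             (suc zero)       _   = (λ ()) , refl
L-isTriangulation zero             (suc (suc zero)) _   = (λ ()) , refl
L-isTriangulation (suc zero)       zero             _   = (λ ()) , refl
L-isTriangulation (suc zero)       (suc zero)       1≢1 = ⊥-elim (1≢1 refl)
L-isTriangulation (suc zero)       (suc (suc zero)) _   = (λ ()) , refl
L-isTriangulation (suc (suc zero)) zero             _   = (λ ()) , refl
L-isTriangulation (suc (suc zero)) (suc zero)       _   = (λ ()) , refl
L-isTriangulation (suc (suc zero)) (suc (suc zero)) 2≢2 = ⊥-elim (2≢2 refl)

isClusterTriangulation⇒isTriangulation : ∀ {T} → IsClusterTriangulation T → IsTriangulation T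
isClusterTriangulation⇒isTriangulation root = L-isTriangulation
isClusterTriangulation⇒isTriangulation (step _ _ (isTriangulation , _)) = isTriangulation

module _ {k : Fin 3} (T T' : Triple) where

  flip-compatibleˡ : IsFlip k T T' → ∀ {m} → m ≢ k → Compatible (T m) (T' k)
  flip-compatibleˡ (isTriangulation , unchanged , _) {m} m≢k =
    compatible-cong {T' m} {T m} {T' k} {T' k} (unchanged m m≢k) (refl , refl)
      (proj₂ (isTriangulation m k m≢k))

  flip-compatibleʳ : IsFlip k T T' → ∀ {m} → m ≢ k → Compatible (T' k) (T m)
  flip-compatibleʳ (isTriangulation , unchanged , _) {m} m≢k =
    compatible-cong {T' k} {T' k} {T' m} {T m} (refl , refl) (unchanged m m≢k)
      (proj₂ (isTriangulation k m (≢-sym m≢k)))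

  flip-changes : IsFlip k T T' → ¬ T' k ≈ₐ T k
  flip-changes (_ , _ , changed) = changed

module Consecutive (a b c : Arc) (ab : det a b ≡ 1ℤ) (bc : det b c ≡ 1ℤ) (ac : det a c ≡ 1ℤ) where

  private
    ba : det b a ≡ -1ℤ
    ba = trans (det-antisym b a) (cong -_ ab)

    cb : det c b ≡ -1ℤ
    cb = trans (det-antisym c b) (cong -_ bc)

  replace-middle : ∀ e → Compatible a e → Compatible e c → ¬ e ≈ₐ b →
                   grad e <ᵍ grad a ⊎ grad c <ᵍ grad e
  replace-middle e ae ec e≉b with position a c ac e ae ec
  ... | below ae≡-1 _   = inj₁ (det≡-1⇒>ᵍ a e ae≡-1)
  ... | above _ ec≡-1   = inj₂ (det≡-1⇒>ᵍ e c ec≡-1)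
  ... | inside ae≡1 ec≡1 =
    ⊥-elim (e≉b (same-coordinates⇒≈ₐ a c ac e b (trans ae≡1 (sym ab)) (trans ec≡1 (sym bc))))

  replace-lowest : ∀ e → Compatible b e → Compatible e c → ¬ e ≈ₐ a →
                   grad b <ᵍ grad e × grad e <ᵍ grad c
  replace-lowest e be ec e≉a with position b c bc e be ec
  ... | inside be≡1 ec≡1  = det≡1⇒<ᵍ b e be≡1 , det≡1⇒<ᵍ e c ec≡1
  ... | below be≡-1 ec≡1  =
    ⊥-elim (e≉a (same-coordinates⇒≈ₐ b c bc e a (trans be≡-1 (sym ba)) (trans ec≡1 (sym ac))))
  ... | above be≡1 ec≡-1 =
    ⊥-elim (opposite-coordinates⇒⊥ b c bc e a
      (trans be≡1 (sym (cong -_ ba))) (trans ec≡-1 (sym (cong -_ ac))))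

  replace-highest : ∀ e → Compatible a e → Compatible e b → ¬ e ≈ₐ c →
                    grad a <ᵍ grad e × grad e <ᵍ grad b
  replace-highest e ae eb e≉c with position a b ab e ae eb
  ... | inside ae≡1 eb≡1  = det≡1⇒<ᵍ a e ae≡1 , det≡1⇒<ᵍ e b eb≡1
  ... | above ae≡1 eb≡-1 =
    ⊥-elim (e≉c (same-coordinates⇒≈ₐ a b ab e c (trans ae≡1 (sym ac)) (trans eb≡-1 (sym cb))))
  ... | below ae≡-1 eb≡1 =
    ⊥-elim (opposite-coordinates⇒⊥ a b ab e c
      (trans ae≡-1 (sym (cong -_ ac))) (trans eb≡1 (sym (cong -_ cb))))

mainTheorem5 : ∀ (T : Triple) → IsClusterTriangulation T →
    ∀ (i j k : Fin 3) → i ≢ j → j ≢ k → i ≢ k →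
    grad (T i) <ᵍ grad (T j) → grad (T j) <ᵍ grad (T k) →
    (∀ T' → IsFlip j T T' →
        (grad (T' j) <ᵍ grad (T i) × grad (T i) <ᵍ grad (T k))
      ⊎ (grad (T i) <ᵍ grad (T k) × grad (T k) <ᵍ grad (T' j)))
    × (∀ T'' → IsFlip i T T'' →
        grad (T j) <ᵍ grad (T'' i) × grad (T'' i) <ᵍ grad (T k))
    × (∀ T''' → IsFlip k T T''' →
        grad (T i) <ᵍ grad (T''' k) × grad (T''' k) <ᵍ grad (T j))
mainTheorem5 T cluster i j k i≢j j≢k i≢k a<b b<c =
    (λ T' flip → Sum.map (_, a<c) (a<c ,_)
      (replace-middle (T' j)
        (flip-compatibleˡ T T' flip i≢j) (flip-compatibleʳ T T' flip (≢-sym j≢k)) (flip-changes T T' flip)))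
  , (λ T' flip → replace-lowest (T' i)
        (flip-compatibleˡ T T' flip (≢-sym i≢j)) (flip-compatibleʳ T T' flip (≢-sym i≢k))
        (flip-changes T T' flip))
  , (λ T' flip → replace-highest (T' k)
        (flip-compatibleˡ T T' flip i≢k) (flip-compatibleʳ T T' flip j≢k) (flip-changes T T' flip))
  where
  isTriangulation : IsTriangulation T
  isTriangulation = isClusterTriangulation⇒isTriangulation cluster

  a<c : grad (T i) <ᵍ grad (T k)
  a<c = <ᵍ-trans a<b b<c

  open Consecutive (T i) (T j) (T k)
    (compatible⇒det≡1 (T i) (T j) (proj₂ (isTriangulation i j i≢j)) a<b)
    (compatible⇒det≡1 (T j) (T k) (proj₂ (isTriangulation j k j≢k)) b<c)
    (compatible⇒det≡1 (T i) (T k) (proj₂ (isTriangulation i k i≢k)) a<c)
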